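{- Let $q=p^\alpha>1$ be a prime power ($p$ prime, $\alpha\geq1$). Let $L\subseteq\{0,\ldots,q-1\}$ be a proper subset. Then there exists a univariate polynomial $F_L(x)\in\mathbb Q[x]$ such that: (1) $F_L(t)\in\mathbb Z$ for each $t\in\mathbb Z$; (2) $F_L$ separates $(\{0,\ldots,q-1\}\setminus L)+q\mathbb Z$ from $L+q\mathbb Z$; (3) $F_L(m)\equiv 1\pmod p$ for each integer $m$ with $m\not\equiv\ell\pmod q$ for all $\ell\in L$, and $F_L(s)\equiv 0\pmod p$ for each integer $s$ with $s\equiv\ell\pmod q$ for some $\ell\in L$; (4) $\deg(F_L)\leq q-1$.
   Context: For a nonzero integer $t$, its $p$-adic valuation $\mathrm{val}(t)$ is the exponent $j$ such that $p^j$ divides $t$ but $p^{j+1}$ does not (with $\mathrm{val}(0)=+\infty$). A polynomial $h$ taking integer values at the relevant integers separates a set $A\subseteq\mathbb Z$ from a set $B\subseteq\mathbb Z$ if $\max\{\mathrm{val}(h(s)) : s\in A\}<\min\{\mathrm{val}(h(s)) : s\in B\}$. For $M\subseteq\mathbb Z$, $M+q\mathbb Z=\{m+qz: m\in M, z\in\mathbb Z\}$. -}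

module Defs where

open import Data.Nat as ℕ using (ℕ; suc; _≤_; _<_)
open import Data.Integer as ℤ using (ℤ)
open import Data.Integer.Divisibility using (_∣_)
open import Data.Rational as ℚ using (ℚ)
open import Data.List using (List; []; _∷_)
open import Data.Fin using (Fin; toℕ)
open import Data.Fin.Subset using (Subset; _∈_; _∉_)
open import Data.Product using (Σ; ∃; _×_)
open import Data.Sum using (_⊎_)
open import Relation.Nullary using (¬_)
open import Relation.Binary.PropositionalEquality using (_≡_)

-- A univariate polynomial over ℚ, given by its coefficient list
-- [a₀, a₁, …, a_k] (lowest degree first), meaning a₀ + a₁ x + … + a_k x^k.
Poly : Set
Poly = List ℚ

ℤ→ℚ : ℤ → ℚ
ℤ→ℚ z = z ℚ./ 1

eval : Poly → ℚ → ℚ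
eval []       x = ℚ.0ℚ
eval (a ∷ as) x = a ℚ.+ x ℚ.* eval as x

-- p-adic valuation as a relation: val(t) = j  iff  p^j ∣ t and p^(j+1) ∤ t
-- (for t = 0 no finite j satisfies this, i.e. val(0) = +∞).
IsVal : ℕ → ℤ → ℕ → Set
IsVal p t j = (ℤ.+ (p ℕ.^ j) ∣ t) × ¬ (ℤ.+ (p ℕ.^ suc j) ∣ t)

_≡_[mod_] : ℤ → ℤ → ℕ → Set
a ≡ b [mod n ] = ℤ.+ n ∣ (a ℤ.- b)

-- h separates A from B:  max{val h(s) : s ∈ A} < min{val h(s) : s ∈ B},
-- with val(0) = +∞.  Since valuations are natural numbers (or +∞), this
-- says: there is a bound k with every s ∈ A having finite valuation ≤ k
-- (so the maximum exists and is ≤ k) and every s ∈ B having valuation > k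
-- (either h(s) = 0, i.e. +∞, or a finite valuation > k).
Separates : ℕ → (ℤ → ℤ) → (ℤ → Set) → (ℤ → Set) → Set
Separates p h A B =
  ∃ λ k →
    (∀ s → A s → ∃ λ j → IsVal p (h s) j × j ≤ k) ×
    (∀ s → B s → (h s ≡ ℤ.0ℤ) ⊎ (∃ λ j → IsVal p (h s) j × k < j))

InLq : (q : ℕ) → Subset q → ℤ → Set
InLq q L s = ∃ λ (ℓ : Fin q) → ℓ ∈ L × (s ≡ ℤ.+ (toℕ ℓ) [mod q ])

InComplLq : (q : ℕ) → Subset q → ℤ → Set
InComplLq q L s = ∃ λ (ℓ : Fin q) → ℓ ∉ L × (s ≡ ℤ.+ (toℕ ℓ) [mod q ])

{-# OPTIONS --safe #-}
module Submission where

-- Take F_L(t) = Σ_{ℓ ∉ L} C(t − ℓ − 1, q − 1), where the binomial coefficient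
-- C(y, k) is extended to all integers y by Pascal's rule.  Since p divides C(q, j) for
-- 0 < j < q, Pascal's rule propagates C(y + q, k) ≡ C(y, k) (mod p) for every k < q.  On the
-- residues 0 ≤ x < q, C(x, q − 1) is 1 at x = q − 1 and 0 elsewhere, so
-- C(t − ℓ − 1, q − 1) ≡ [t ≡ ℓ (mod q)] and F_L(t) ≡ [t mod q ∉ L] (mod p): F_L has
-- valuation 0 off L + qℤ and positive valuation (or vanishes) on it.  F_L is a rational
-- polynomial of degree q − 1 because (k + 1) C(y, k + 1) = (y − k) C(y, k).

open import Defs
open import Data.Fin as Fin using (Fin; toℕ)
import Data.Fin.Properties as FinP
open import Data.Fin.Subset using (Subset; _∈_; _∉_; _⊂_; ⊤)
open import Data.Fin.Subset.Properties using (_∈?_)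
open import Data.Integer as ℤ using (ℤ; +_; -[1+_]; 0ℤ; 1ℤ; _+_; _*_; _-_; -_)
import Data.Integer.DivMod as ℤDM
open import Data.Integer.Divisibility.Signed as ℤD using (divides; ∣ᵤ⇒∣; ∣⇒∣ᵤ)
import Data.Integer.Properties as ℤP
open import Algebra.Properties.Monoid.Sum ℤP.+-0-monoid using (sum)
open import Data.Integer.Tactic.RingSolver using (solve-∀)
open import Data.List using ([]; _∷_; length; map)
import Data.List.Properties as ListP
open import Data.Nat as ℕ using (ℕ; zero; suc; _≤_; _<_; _^_)
import Data.Nat.Coprimality as Coprimality
import Data.Nat.Divisibility as ℕD
open import Data.Nat.Induction using (<-rec)
open import Data.Nat.Primality using (Prime; euclidsLemma; prime⇒nonZero; prime⇒nonTrivial)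
import Data.Nat.Properties as ℕP
import Data.Nat.Tactic.RingSolver as ℕ-Solver
open import Data.Product using (∃; _×_; _,_)
open import Data.Rational as ℚ using (ℚ; mkℚ; 0ℚ; 1ℚ)
import Data.Rational.Properties as ℚP
open import Data.Rational.Solver using (module +-*-Solver)
open import Data.Sum using (_⊎_; inj₁; inj₂)
open import Function using (_∘_)
open import Level using (0ℓ)
open import Relation.Binary.Bundles using (Setoid)
open import Relation.Binary.Definitions using (tri<; tri≈; tri>)
open import Relation.Binary.PropositionalEquality
open import Relation.Binary.Structures using (IsEquivalence)
open import Relation.Nullary using (¬_; yes; no; contradiction)

ℤ-induction : ∀ {ℓ} (P : ℤ → Set ℓ) → P 0ℤ →
              (∀ y → P y → P (ℤ.suc y)) → (∀ y → P (ℤ.suc y) → P y) → ∀ y → P y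
ℤ-induction P P0 up down = go
  where
  go : ∀ y → P y
  go (+ zero)      = P0
  go (+ suc n)     = up (+ n) (go (+ n))
  go -[1+ zero ]   = down -[1+ zero ] P0
  go -[1+ suc n ]  = down -[1+ suc n ] (go -[1+ n ])

-- Defs' _≡_[mod_] is phrased through ∣ a - b ∣, from which Agda cannot recover a and b;
-- keeping them as indices of a record lets congruences be chained with implicit arguments.
infix 4 _≈_[mod_]

record _≈_[mod_] (a b : ℤ) (d : ℕ) : Set where
  constructor congruent
  field divides-difference : + d ℤD.∣ a - b

open _≈_[mod_]

≈⇒≡-mod : ∀ {d a b} → a ≈ b [mod d ] → a ≡ b [mod d ]
≈⇒≡-mod = ∣⇒∣ᵤ ∘ divides-difference

≡-mod⇒≈ : ∀ {d} a b → a ≡ b [mod d ] → a ≈ b [mod d ]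
≡-mod⇒≈ a b a≡b = congruent (∣ᵤ⇒∣ a≡b)

module _ {d : ℕ} where

  private
    congruent-by : ∀ {a b x} → x ≡ a - b → + d ℤD.∣ x → a ≈ b [mod d ]
    congruent-by refl = congruent

  ≈-reflexive : ∀ {a b} → a ≡ b → a ≈ b [mod d ]
  ≈-reflexive {a} refl = congruent (divides 0ℤ (trans (ℤP.+-inverseʳ a) (sym (ℤP.*-zeroˡ (+ d)))))

  ≈-sym : ∀ {a b} → a ≈ b [mod d ] → b ≈ a [mod d ]
  ≈-sym {a} {b} (congruent d∣a-b) = congruent-by (flip a b) (ℤD.∣m⇒∣-m d∣a-b)
    where
    flip : ∀ a b → - (a - b) ≡ b - a
    flip = solve-∀

  ≈-trans : ∀ {a b c} → a ≈ b [mod d ] → b ≈ c [mod d ] → a ≈ c [mod d ]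
  ≈-trans {a} {b} {c} (congruent d∣a-b) (congruent d∣b-c) =
    congruent-by (telescope a b c) (ℤD.∣m∣n⇒∣m+n d∣a-b d∣b-c)
    where
    telescope : ∀ a b c → (a - b) + (b - c) ≡ a - c
    telescope = solve-∀

  ≈-+-cong : ∀ {a b c e} → a ≈ b [mod d ] → c ≈ e [mod d ] → a + c ≈ b + e [mod d ]
  ≈-+-cong {a} {b} {c} {e} (congruent d∣a-b) (congruent d∣c-e) =
    congruent-by (regroup a b c e) (ℤD.∣m∣n⇒∣m+n d∣a-b d∣c-e)
    where
    regroup : ∀ a b c e → (a - b) + (c - e) ≡ (a + c) - (b + e)
    regroup = solve-∀

  ≈-*-congˡ : ∀ c {a b} → a ≈ b [mod d ] → c * a ≈ c * b [mod d ]
  ≈-*-congˡ c {a} {b} (congruent d∣a-b) =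
    congruent-by (distrib c a b) (ℤD.∣n⇒∣m*n c d∣a-b)
    where
    distrib : ∀ c a b → c * (a - b) ≡ c * a - c * b
    distrib = solve-∀

  ≈⇒multiple : ∀ {a b} → a ≈ b [mod d ] → ∃ λ m → a ≡ b + m * + d
  ≈⇒multiple {a} {b} (congruent (divides m a-b≡m*d)) =
    m , trans (cancel a b) (cong (λ x → b + x) a-b≡m*d)
    where
    cancel : ∀ a b → a ≡ b + (a - b)
    cancel = solve-∀

  ∣⇒≈0 : ∀ {a} → + d ℤD.∣ a → a ≈ 0ℤ [mod d ]
  ∣⇒≈0 {a} = congruent-by (sym (ℤP.+-identityʳ a))

  ≈0⇒∣ : ∀ {a} → a ≈ 0ℤ [mod d ] → + d ℤD.∣ a
  ≈0⇒∣ {a} = subst (λ x → + d ℤD.∣ x) (ℤP.+-identityʳ a) ∘ divides-difference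

  multiple⇒≈ : ∀ {a b} m → a ≡ b + m * + d → a ≈ b [mod d ]
  multiple⇒≈ {b = b} m refl = congruent (divides m (cancel b (m * + d)))
    where
    cancel : ∀ b x → b + x - b ≡ x
    cancel = solve-∀

  ≈-neg-cong : ∀ {a b} → a ≈ b [mod d ] → - a ≈ - b [mod d ]
  ≈-neg-cong {a} {b} (congruent d∣a-b) = congruent-by (negate a b) (ℤD.∣m⇒∣-m d∣a-b)
    where
    negate : ∀ a b → - (a - b) ≡ - a - - b
    negate = solve-∀

  ≈-isEquivalence : IsEquivalence (λ a b → a ≈ b [mod d ])
  ≈-isEquivalence = record { refl = ≈-reflexive refl ; sym = ≈-sym ; trans = ≈-trans }

≈-setoid : ℕ → Setoid 0ℓ 0ℓ
≈-setoid d = record { isEquivalence = ≈-isEquivalence {d} }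

residue : ∀ {d} .{{_ : ℕ.NonZero d}} → ℤ → Fin d
residue {d} t = Fin.fromℕ< (ℤDM.n%ℕd<d t d)

≈-residue : ∀ {d} .{{_ : ℕ.NonZero d}} t → t ≈ + toℕ (residue {d} t) [mod d ]
≈-residue {d} t = multiple⇒≈ (t ℤ./ℕ d)
  (trans (ℤDM.a≡a%ℕn+[a/ℕn]*n t d) (cong (λ r → + r + (t ℤ./ℕ d) * + d) (sym (FinP.toℕ-fromℕ< _))))

avoiding⇒InComplLq : ∀ {d} .{{_ : ℕ.NonZero d}} (L : Subset d) s →
                     (∀ ℓ → ℓ ∈ L → ¬ (s ≡ + toℕ ℓ [mod d ])) → InComplLq d L s
avoiding⇒InComplLq L s avoids = residue s , (λ r∈L → avoids _ r∈L s≡r) , s≡r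
  where
  s≡r = ≈⇒≡-mod (≈-residue s)

module _ {d : ℕ} where

  ≈-by-differences : ∀ {f g : ℤ → ℤ} → f 0ℤ ≈ g 0ℤ [mod d ] →
                     (∀ y → f (ℤ.suc y) - f y ≈ g (ℤ.suc y) - g y [mod d ]) →
                     ∀ y → f y ≈ g y [mod d ]
  ≈-by-differences {f} {g} f0≈g0 Δf≈Δg = ℤ-induction (λ y → f y ≈ g y [mod d ]) f0≈g0 up down
    where
    open import Relation.Binary.Reasoning.Setoid (≈-setoid d)
    forward : ∀ a b → b ≡ a + (b - a)
    forward = solve-∀
    backward : ∀ a b → a ≡ b - (b - a)
    backward = solve-∀
    up : ∀ y → f y ≈ g y [mod d ] → f (ℤ.suc y) ≈ g (ℤ.suc y) [mod d ]
    up y fy≈gy = begin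
      f (ℤ.suc y)                   ≡⟨ forward (f y) (f (ℤ.suc y)) ⟩
      f y + (f (ℤ.suc y) - f y)     ≈⟨ ≈-+-cong fy≈gy (Δf≈Δg y) ⟩
      g y + (g (ℤ.suc y) - g y)     ≡⟨ forward (g y) (g (ℤ.suc y)) ⟨
      g (ℤ.suc y)                   ∎
    down : ∀ y → f (ℤ.suc y) ≈ g (ℤ.suc y) [mod d ] → f y ≈ g y [mod d ]
    down y fsy≈gsy = begin
      f y                                   ≡⟨ backward (f y) (f (ℤ.suc y)) ⟩
      f (ℤ.suc y) - (f (ℤ.suc y) - f y)     ≈⟨ ≈-+-cong fsy≈gsy (≈-neg-cong (Δf≈Δg y)) ⟩
      g (ℤ.suc y) - (g (ℤ.suc y) - g y)     ≡⟨ backward (g y) (g (ℤ.suc y)) ⟨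
      g y                                   ∎

≈-mod-0⇒≡ : ∀ {a b} → a ≈ b [mod 0 ] → a ≡ b
≈-mod-0⇒≡ {a} {b} (congruent (divides m a-b≡m*0)) = ℤP.i-j≡0⇒i≡j a b (trans a-b≡m*0 (ℤP.*-zeroʳ m))

≡-by-differences : ∀ {f g : ℤ → ℤ} → f 0ℤ ≡ g 0ℤ →
                   (∀ y → f (ℤ.suc y) - f y ≡ g (ℤ.suc y) - g y) → ∀ y → f y ≡ g y
≡-by-differences {f} {g} f0≡g0 Δf≡Δg y =
  ≈-mod-0⇒≡ (≈-by-differences {f = f} {g} (≈-reflexive f0≡g0) (≈-reflexive ∘ Δf≡Δg) y)

≈-periodic-multiples : ∀ {d c} {f : ℤ → ℤ} → (∀ y → f (y + c) ≈ f y [mod d ]) →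
                       ∀ m y → f (y + m * c) ≈ f y [mod d ]
≈-periodic-multiples {d} {c} {f} period = ℤ-induction P base up down
  where
  open import Relation.Binary.Reasoning.Setoid (≈-setoid d)
  P : ℤ → Set
  P m = ∀ y → f (y + m * c) ≈ f y [mod d ]
  unit : ∀ y c → y + 0ℤ * c ≡ y
  unit = solve-∀
  peel : ∀ y m c → y + (1ℤ + m) * c ≡ (y + m * c) + c
  peel = solve-∀
  base : P 0ℤ
  base y = ≈-reflexive (cong f (unit y c))
  up : ∀ m → P m → P (ℤ.suc m)
  up m Pm y = begin
    f (y + ℤ.suc m * c)   ≡⟨ cong f (peel y m c) ⟩
    f (y + m * c + c)     ≈⟨ period (y + m * c) ⟩
    f (y + m * c)         ≈⟨ Pm y ⟩
    f y                   ∎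
  down : ∀ m → P (ℤ.suc m) → P m
  down m Psm y = begin
    f (y + m * c)         ≈⟨ period (y + m * c) ⟨
    f (y + m * c + c)     ≡⟨ cong f (peel y m c) ⟨
    f (y + ℤ.suc m * c)   ≈⟨ Psm y ⟩
    f y                   ∎

sum-≈0 : ∀ {d k} (f : Fin k → ℤ) → (∀ j → f j ≈ 0ℤ [mod d ]) → sum f ≈ 0ℤ [mod d ]
sum-≈0 {k = zero}  f _    = ≈-reflexive refl
sum-≈0 {k = suc k} f f≈0 = ≈-+-cong (f≈0 Fin.zero) (sum-≈0 (f ∘ Fin.suc) (f≈0 ∘ Fin.suc))

sum-select-≈ : ∀ {d k} (f : Fin k → ℤ) i → (∀ j → j ≢ i → f j ≈ 0ℤ [mod d ]) → sum f ≈ f i [mod d ]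
sum-select-≈ f Fin.zero off = ≈-trans
  (≈-+-cong (≈-reflexive {a = f Fin.zero} refl) (sum-≈0 (f ∘ Fin.suc) (λ j → off (Fin.suc j) λ ())))
  (≈-reflexive (ℤP.+-identityʳ (f Fin.zero)))
sum-select-≈ f (Fin.suc i) off = ≈-trans
  (≈-+-cong (off Fin.zero λ ())
            (sum-select-≈ (f ∘ Fin.suc) i (λ j j≢i → off (Fin.suc j) (j≢i ∘ FinP.suc-injective))))
  (≈-reflexive (ℤP.+-identityˡ (f (Fin.suc i))))

prime-power-divisor : ∀ {p m n} → Prime p → ¬ p ℕD.∣ n → ∀ α → p ^ α ℕD.∣ m ℕ.* n → p ^ α ℕD.∣ m
prime-power-divisor _ _ zero _ = ℕD.1∣ _
prime-power-divisor {p} {m} {n} p-prime p∤n (suc α) pp^α∣m*n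
  with euclidsLemma m n p-prime (ℕD.∣-trans (ℕD.m∣m*n (p ^ α)) pp^α∣m*n)
... | inj₂ p∣n = contradiction p∣n p∤n
... | inj₁ (ℕD.divides c refl) = subst (p ℕ.* p ^ α ℕD.∣_) (ℕP.*-comm p c) (ℕD.*-monoʳ-∣ p p^α∣c)
  where
  instance _ = prime⇒nonZero p-prime
  regroup : ∀ c p n → c ℕ.* p ℕ.* n ≡ p ℕ.* (c ℕ.* n)
  regroup = ℕ-Solver.solve-∀
  p^α∣c : p ^ α ℕD.∣ c
  p^α∣c = prime-power-divisor p-prime p∤n α
            (ℕD.*-cancelˡ-∣ p (subst (p ℕ.* p ^ α ℕD.∣_) (regroup c p n) pp^α∣m*n))

valuation : ∀ {p} → 1 < p → ∀ t → t ≢ 0ℤ → ∃ (IsVal p t)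
valuation {p} 1<p t t≢0 = <-rec P step ℤ.∣ t ∣ (t≢0 ∘ ℤP.∣i∣≡0⇒i≡0)
  where
  instance _ = ℕ.>-nonZero (ℕP.<-trans ℕP.0<1+n 1<p)
  P : ℕ → Set
  P N = N ≢ 0 → ∃ λ j → p ^ j ℕD.∣ N × ¬ p ^ suc j ℕD.∣ N
  step : ∀ N → (∀ {M} → M < N → P M) → P N
  step N rec N≢0 with p ℕD.∣? N
  ... | no p∤N = 0 , ℕD.1∣ N , p∤N ∘ subst (ℕD._∣ N) (ℕP.*-identityʳ p)
  ... | yes (ℕD.divides c refl) with rec (ℕP.m<m*n c p 1<p) c≢0
    where
    c≢0 : c ≢ 0
    c≢0 refl = N≢0 refl
    instance _ = ℕ.≢-nonZero c≢0
  ...   | j , p^j∣c , p^1+j∤c =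
    suc j , subst (p ^ suc j ℕD.∣_) (ℕP.*-comm p c) (ℕD.*-monoʳ-∣ p p^j∣c) ,
    p^1+j∤c ∘ ℕD.*-cancelˡ-∣ p ∘ subst (p ^ suc (suc j) ℕD.∣_) (ℕP.*-comm c p)

separates-by-residues : ∀ {p} {h : ℤ → ℤ} {A B : ℤ → Set} → 1 < p →
                        (∀ s → A s → h s ≈ 1ℤ [mod p ]) → (∀ s → B s → h s ≈ 0ℤ [mod p ]) →
                        Separates p h A B
separates-by-residues {p} {h} {A} {B} 1<p h≈1 h≈0 = 0 , valuation-0 , valuation-positive
  where
  p^1≡p : p ^ 1 ≡ p
  p^1≡p = ℕP.*-identityʳ p
  p∤unit : ∀ {a} → a ≈ 1ℤ [mod p ] → ¬ + p ℤD.∣ a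
  p∤unit {a} (congruent p∣a-1) p∣a = ℕP.<⇒≢ 1<p (sym (ℕD.∣1⇒≡1 (∣⇒∣ᵤ p∣1)))
    where
    unit : ∀ a → a - (a - 1ℤ) ≡ 1ℤ
    unit = solve-∀
    p∣1 : + p ℤD.∣ 1ℤ
    p∣1 = subst (λ x → + p ℤD.∣ x) (unit a) (ℤD.∣m∣n⇒∣m-n p∣a p∣a-1)
  valuation-0 : ∀ s → A s → ∃ λ j → IsVal p (h s) j × j ≤ 0
  valuation-0 s As = 0 , (ℕD.1∣ _ , p∤unit (h≈1 s As) ∘ ∣ᵤ⇒∣ ∘ subst (ℕD._∣ _) p^1≡p) , ℕ.z≤n
  valuation-positive : ∀ s → B s → h s ≡ 0ℤ ⊎ ∃ λ j → IsVal p (h s) j × 0 < j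
  valuation-positive s Bs with h s ℤP.≟ 0ℤ
  ... | yes hs≡0 = inj₁ hs≡0
  ... | no hs≢0 with valuation 1<p (h s) hs≢0
  ...   | zero  , _ , p∤hs = contradiction (∣⇒∣ᵤ (≈0⇒∣ (h≈0 s Bs))) (p∤hs ∘ subst (ℕD._∣ _) (sym p^1≡p))
  ...   | suc j , val     = inj₂ (suc j , val , ℕ.s≤s ℕ.z≤n)

-- Pascal's rule C(y + 1, k + 1) = C(y, k + 1) + C(y, k), read forwards for y ≥ 0
-- and solved for C(y, k + 1) for y < 0.
binomial : ℤ → ℕ → ℤ
binomial _             zero    = 1ℤ
binomial (+ zero)      (suc k) = 0ℤ
binomial (+ suc n)     (suc k) = binomial (+ n) (suc k) + binomial (+ n) k
binomial -[1+ zero ]   (suc k) = - binomial -[1+ zero ] k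
binomial -[1+ suc n ]  (suc k) = binomial -[1+ n ] (suc k) - binomial -[1+ suc n ] k

binomial-pascal : ∀ y k → binomial (ℤ.suc y) (suc k) ≡ binomial y (suc k) + binomial y k
binomial-pascal (+ n)          k = refl
binomial-pascal -[1+ zero ]    k = sym (ℤP.+-inverseˡ (binomial -[1+ zero ] k))
binomial-pascal -[1+ suc n ]   k = cancel (binomial -[1+ n ] (suc k)) (binomial -[1+ suc n ] k)
  where
  cancel : ∀ a b → a ≡ (a - b) + b
  cancel = solve-∀

binomial-Δ : ∀ y k → binomial (ℤ.suc y) (suc k) - binomial y (suc k) ≡ binomial y k
binomial-Δ y k =
  trans (cong (_- binomial y (suc k)) (binomial-pascal y k)) (cancel (binomial y (suc k)) (binomial y k))
  where
  cancel : ∀ a b → (a + b) - a ≡ b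
  cancel = solve-∀

binomial-below : ∀ {x k} → x < k → binomial (+ x) k ≡ 0ℤ
binomial-below {zero}  {suc k} _ = refl
binomial-below {suc x} {suc k} (ℕ.s≤s x<k) =
  cong₂ _+_ (binomial-below (ℕP.m<n⇒m<1+n x<k)) (binomial-below x<k)

binomial-diagonal : ∀ n → binomial (+ n) n ≡ 1ℤ
binomial-diagonal zero    = refl
binomial-diagonal (suc n) = cong₂ _+_ (binomial-below (ℕP.n<1+n n)) (binomial-diagonal n)

binomial-absorption : ∀ k y → + suc k * binomial y (suc k) ≡ (y - + k) * binomial y k
binomial-absorption zero = ≡-by-differences refl Δ
  where
  Δ : ∀ y → + 1 * binomial (ℤ.suc y) 1 - + 1 * binomial y 1 ≡ (ℤ.suc y - + 0) * 1ℤ - (y - + 0) * 1ℤ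
  Δ y = begin
    + 1 * binomial (ℤ.suc y) 1 - + 1 * binomial y 1 ≡⟨ cong (λ c → + 1 * c - + 1 * binomial y 1) (binomial-pascal y 0) ⟩
    + 1 * (binomial y 1 + 1ℤ) - + 1 * binomial y 1  ≡⟨ both-differences-one y (binomial y 1) ⟩
    (ℤ.suc y - + 0) * 1ℤ - (y - + 0) * 1ℤ           ∎
    where
    open ≡-Reasoning
    both-differences-one : ∀ y c → 1ℤ * (c + 1ℤ) - 1ℤ * c ≡ ((1ℤ + y) - 0ℤ) * 1ℤ - (y - 0ℤ) * 1ℤ
    both-differences-one = solve-∀
binomial-absorption (suc j) = ≡-by-differences base Δ
  where
  open ≡-Reasoning
  base : + suc (suc j) * 0ℤ ≡ (0ℤ - + suc j) * 0ℤ
  base = trans (ℤP.*-zeroʳ (+ suc (suc j))) (sym (ℤP.*-zeroʳ (0ℤ - + suc j)))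
  Δ : ∀ y → + suc (suc j) * binomial (ℤ.suc y) (suc (suc j)) - + suc (suc j) * binomial y (suc (suc j))
          ≡ (ℤ.suc y - + suc j) * binomial (ℤ.suc y) (suc j) - (y - + suc j) * binomial y (suc j)
  Δ y = begin
    + suc (suc j) * binomial (ℤ.suc y) (suc (suc j)) - + suc (suc j) * a
      ≡⟨ cong (λ c → + suc (suc j) * c - + suc (suc j) * a) (binomial-pascal y (suc j)) ⟩
    + suc (suc j) * (a + b) - + suc (suc j) * a
      ≡⟨ lhs-difference (+ j) a b ⟩
    + suc j * b + b
      ≡⟨ cong (_+ b) (binomial-absorption j y) ⟩
    (y - + j) * c + b
      ≡⟨ rhs-difference y (+ j) b c ⟩
    (ℤ.suc y - + suc j) * (b + c) - (y - + suc j) * b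
      ≡⟨ cong (λ e → (ℤ.suc y - + suc j) * e - (y - + suc j) * b) (binomial-pascal y j) ⟨
    (ℤ.suc y - + suc j) * binomial (ℤ.suc y) (suc j) - (y - + suc j) * b ∎
    where
    a = binomial y (suc (suc j))
    b = binomial y (suc j)
    c = binomial y j
    lhs-difference : ∀ j a b → (1ℤ + (1ℤ + j)) * (a + b) - (1ℤ + (1ℤ + j)) * a ≡ (1ℤ + j) * b + b
    lhs-difference = solve-∀
    rhs-difference : ∀ y j b c → (y - j) * c + b ≡ ((1ℤ + y) - (1ℤ + j)) * (b + c) - (y - (1ℤ + j)) * b
    rhs-difference = solve-∀

binomial-absorption-suc : ∀ k y → + suc k * binomial (ℤ.suc y) (suc k) ≡ ℤ.suc y * binomial y k
binomial-absorption-suc k y = begin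
  + suc k * binomial (ℤ.suc y) (suc k)            ≡⟨ cong (+ suc k *_) (binomial-pascal y k) ⟩
  + suc k * (binomial y (suc k) + binomial y k)   ≡⟨ ℤP.*-distribˡ-+ (+ suc k) (binomial y (suc k)) c ⟩
  + suc k * binomial y (suc k) + + suc k * c      ≡⟨ cong (_+ + suc k * c) (binomial-absorption k y) ⟩
  (y - + k) * c + + suc k * c                     ≡⟨ collect y (+ k) c ⟩
  ℤ.suc y * c                                     ∎
  where
  open ≡-Reasoning
  c = binomial y k
  collect : ∀ y k c → (y - k) * c + (1ℤ + k) * c ≡ (1ℤ + y) * c
  collect = solve-∀

-- ℤ→ℚ z normalises z / 1, which does not compute for a variable z; whole z is the same
-- rational as a literal record, on which ℚ's arithmetic computes.
private
  whole : ℤ → ℚ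
  whole z = mkℚ z 0 (Coprimality.sym (Coprimality.1-coprimeTo _))

  ℤ→ℚ≡whole : ∀ z → ℤ→ℚ z ≡ whole z
  ℤ→ℚ≡whole z = ℚP.↥p/↧p≡p (whole z)

ℤ→ℚ-+ : ∀ a b → ℤ→ℚ (a + b) ≡ ℤ→ℚ a ℚ.+ ℤ→ℚ b
ℤ→ℚ-+ a b = begin
  ℤ→ℚ (a + b)            ≡⟨ ℚP./-cong (cong₂ _+_ (ℤP.*-identityʳ a) (ℤP.*-identityʳ b)) refl ⟨
  whole a ℚ.+ whole b    ≡⟨ cong₂ ℚ._+_ (ℤ→ℚ≡whole a) (ℤ→ℚ≡whole b) ⟨
  ℤ→ℚ a ℚ.+ ℤ→ℚ b        ∎
  where open ≡-Reasoning

ℤ→ℚ-* : ∀ a b → ℤ→ℚ (a * b) ≡ ℤ→ℚ a ℚ.* ℤ→ℚ b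
ℤ→ℚ-* a b = sym (cong₂ ℚ._*_ (ℤ→ℚ≡whole a) (ℤ→ℚ≡whole b))

infixl 6 _+ᴾ_
infixl 7 _·ᴾ_

_+ᴾ_ : Poly → Poly → Poly
[]      +ᴾ Q       = Q
(a ∷ P) +ᴾ []      = a ∷ P
(a ∷ P) +ᴾ (b ∷ Q) = (a ℚ.+ b) ∷ (P +ᴾ Q)

_·ᴾ_ : ℚ → Poly → Poly
c ·ᴾ P = map (c ℚ.*_) P

open +-*-Solver using (solve; _:+_; _:*_; _:=_)

eval-+ᴾ : ∀ P Q x → eval (P +ᴾ Q) x ≡ eval P x ℚ.+ eval Q x
eval-+ᴾ []      Q       x = sym (ℚP.+-identityˡ (eval Q x))
eval-+ᴾ (a ∷ P) []      x = sym (ℚP.+-identityʳ (a ℚ.+ x ℚ.* eval P x))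
eval-+ᴾ (a ∷ P) (b ∷ Q) x =
  trans (cong (λ e → (a ℚ.+ b) ℚ.+ x ℚ.* e) (eval-+ᴾ P Q x)) (interleave a b x (eval P x) (eval Q x))
  where
  interleave : ∀ a b x u v → (a ℚ.+ b) ℚ.+ x ℚ.* (u ℚ.+ v) ≡ (a ℚ.+ x ℚ.* u) ℚ.+ (b ℚ.+ x ℚ.* v)
  interleave = solve 5 (λ a b x u v → (a :+ b) :+ x :* (u :+ v) := (a :+ x :* u) :+ (b :+ x :* v)) refl

eval-·ᴾ : ∀ c P x → eval (c ·ᴾ P) x ≡ c ℚ.* eval P x
eval-·ᴾ c []      x = sym (ℚP.*-zeroʳ c)
eval-·ᴾ c (a ∷ P) x =
  trans (cong (λ e → c ℚ.* a ℚ.+ x ℚ.* e) (eval-·ᴾ c P x)) (factor c a x (eval P x))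
  where
  factor : ∀ c a x u → c ℚ.* a ℚ.+ x ℚ.* (c ℚ.* u) ≡ c ℚ.* (a ℚ.+ x ℚ.* u)
  factor = solve 4 (λ c a x u → c :* a :+ x :* (c :* u) := c :* (a :+ x :* u)) refl

length-·ᴾ : ∀ c P → length (c ·ᴾ P) ≡ length P
length-·ᴾ c = ListP.length-map (c ℚ.*_)

length-+ᴾ : ∀ {N} P Q → length P ≤ N → length Q ≤ N → length (P +ᴾ Q) ≤ N
length-+ᴾ []      Q       _            Q≤N          = Q≤N
length-+ᴾ (a ∷ P) []      P≤N          _            = P≤N
length-+ᴾ (a ∷ P) (b ∷ Q) (ℕ.s≤s P≤N) (ℕ.s≤s Q≤N) = ℕ.s≤s (length-+ᴾ P Q P≤N Q≤N)

record PolynomialOfDegree< (n : ℕ) (f : ℤ → ℤ) : Set where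
  field
    coefficients : Poly
    length≤      : length coefficients ≤ n
    eval≡        : ∀ t → eval coefficients (ℤ→ℚ t) ≡ ℤ→ℚ (f t)

open PolynomialOfDegree<

module _ {n : ℕ} where

  zero-polynomial : PolynomialOfDegree< n (λ _ → 0ℤ)
  zero-polynomial = record { coefficients = [] ; length≤ = ℕ.z≤n ; eval≡ = λ _ → refl }

  +-polynomial : ∀ {f g} → PolynomialOfDegree< n f → PolynomialOfDegree< n g →
                 PolynomialOfDegree< n (λ t → f t + g t)
  +-polynomial {f} {g} F G = record
    { coefficients = P +ᴾ Q
    ; length≤      = length-+ᴾ P Q (length≤ F) (length≤ G)
    ; eval≡        = λ t → begin
        eval (P +ᴾ Q) (ℤ→ℚ t)                   ≡⟨ eval-+ᴾ P Q (ℤ→ℚ t) ⟩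
        eval P (ℤ→ℚ t) ℚ.+ eval Q (ℤ→ℚ t)       ≡⟨ cong₂ ℚ._+_ (eval≡ F t) (eval≡ G t) ⟩
        ℤ→ℚ (f t) ℚ.+ ℤ→ℚ (g t)                 ≡⟨ ℤ→ℚ-+ (f t) (g t) ⟨
        ℤ→ℚ (f t + g t)                          ∎
    }
    where
    open ≡-Reasoning
    P = coefficients F
    Q = coefficients G

  sum-polynomial : ∀ {k} {f : Fin k → ℤ → ℤ} → (∀ i → PolynomialOfDegree< n (f i)) →
                   PolynomialOfDegree< n (λ t → sum (λ i → f i t))
  sum-polynomial {zero}  _ = zero-polynomial
  sum-polynomial {suc k} F = +-polynomial (F Fin.zero) (sum-polynomial (F ∘ Fin.suc))

  scale-polynomial : ∀ c {f} → PolynomialOfDegree< n f → PolynomialOfDegree< n (λ t → c * f t)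
  scale-polynomial c {f} F = record
    { coefficients = ℤ→ℚ c ·ᴾ P
    ; length≤      = subst (_≤ n) (sym (length-·ᴾ (ℤ→ℚ c) P)) (length≤ F)
    ; eval≡        = λ t → begin
        eval (ℤ→ℚ c ·ᴾ P) (ℤ→ℚ t)     ≡⟨ eval-·ᴾ (ℤ→ℚ c) P (ℤ→ℚ t) ⟩
        ℤ→ℚ c ℚ.* eval P (ℤ→ℚ t)      ≡⟨ cong (ℤ→ℚ c ℚ.*_) (eval≡ F t) ⟩
        ℤ→ℚ c ℚ.* ℤ→ℚ (f t)           ≡⟨ ℤ→ℚ-* c (f t) ⟨
        ℤ→ℚ (c * f t)                 ∎
    }
    where
    open ≡-Reasoning
    P = coefficients F

  linear-factor-polynomial : ∀ a b {f h} → PolynomialOfDegree< n f →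
                             (∀ t → ℤ→ℚ (h t) ≡ (a ℚ.+ b ℚ.* ℤ→ℚ t) ℚ.* ℤ→ℚ (f t)) →
                             PolynomialOfDegree< (suc n) h
  linear-factor-polynomial a b {f} {h} F h≡ = record
    { coefficients = a ·ᴾ P +ᴾ (0ℚ ∷ b ·ᴾ P)
    ; length≤      = length-+ᴾ (a ·ᴾ P) (0ℚ ∷ b ·ᴾ P)
                       (ℕP.m≤n⇒m≤1+n (subst (_≤ n) (sym (length-·ᴾ a P)) (length≤ F)))
                       (ℕ.s≤s (subst (_≤ n) (sym (length-·ᴾ b P)) (length≤ F)))
    ; eval≡        = λ t → let x = ℤ→ℚ t; u = eval P x in begin
        eval (a ·ᴾ P +ᴾ (0ℚ ∷ b ·ᴾ P)) x                   ≡⟨ eval-+ᴾ (a ·ᴾ P) (0ℚ ∷ b ·ᴾ P) x ⟩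
        eval (a ·ᴾ P) x ℚ.+ (0ℚ ℚ.+ x ℚ.* eval (b ·ᴾ P) x)
          ≡⟨ cong₂ (λ v w → v ℚ.+ (0ℚ ℚ.+ x ℚ.* w)) (eval-·ᴾ a P x) (eval-·ᴾ b P x) ⟩
        a ℚ.* u ℚ.+ (0ℚ ℚ.+ x ℚ.* (b ℚ.* u))               ≡⟨ cong (a ℚ.* u ℚ.+_) (ℚP.+-identityˡ (x ℚ.* (b ℚ.* u))) ⟩
        a ℚ.* u ℚ.+ x ℚ.* (b ℚ.* u)                        ≡⟨ collect a b x u ⟩
        (a ℚ.+ b ℚ.* x) ℚ.* u                              ≡⟨ cong ((a ℚ.+ b ℚ.* x) ℚ.*_) (eval≡ F t) ⟩
        (a ℚ.+ b ℚ.* x) ℚ.* ℤ→ℚ (f t)                      ≡⟨ h≡ t ⟨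
        ℤ→ℚ (h t)                                          ∎
    }
    where
    open ≡-Reasoning
    P = coefficients F
    collect : ∀ a b x u → a ℚ.* u ℚ.+ x ℚ.* (b ℚ.* u) ≡ (a ℚ.+ b ℚ.* x) ℚ.* u
    collect = solve 4 (λ a b x u → a :* u :+ x :* (b :* u) := (a :+ b :* x) :* u) refl

binomial-polynomial : ∀ c k → PolynomialOfDegree< (suc k) (λ t → binomial (t - c) k)
binomial-polynomial c zero = record
  { coefficients = 1ℚ ∷ []
  ; length≤      = ℕP.≤-refl
  ; eval≡        = λ t → trans (cong (1ℚ ℚ.+_) (ℚP.*-zeroʳ (ℤ→ℚ t))) (ℚP.+-identityʳ 1ℚ)
  }
binomial-polynomial c (suc k) =
  linear-factor-polynomial (ℤ→ℚ (- (c + + k)) ℚ.* r) r (binomial-polynomial c k) step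
  where
  open ≡-Reasoning
  r : ℚ
  r = ℚ.1/ whole (+ suc k)
  step : ∀ t → ℤ→ℚ (binomial (t - c) (suc k))
             ≡ (ℤ→ℚ (- (c + + k)) ℚ.* r ℚ.+ r ℚ.* ℤ→ℚ t) ℚ.* ℤ→ℚ (binomial (t - c) k)
  step t = begin
    ℤ→ℚ b′                                              ≡⟨ ℚP.*-identityˡ (ℤ→ℚ b′) ⟨
    1ℚ ℚ.* ℤ→ℚ b′                                       ≡⟨ cong (ℚ._* ℤ→ℚ b′) (ℚP.*-inverseˡ (whole (+ suc k))) ⟨
    r ℚ.* whole (+ suc k) ℚ.* ℤ→ℚ b′                    ≡⟨ cong (λ w → r ℚ.* w ℚ.* ℤ→ℚ b′) (ℤ→ℚ≡whole (+ suc k)) ⟨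
    r ℚ.* ℤ→ℚ (+ suc k) ℚ.* ℤ→ℚ b′                      ≡⟨ ℚP.*-assoc r (ℤ→ℚ (+ suc k)) (ℤ→ℚ b′) ⟩
    r ℚ.* (ℤ→ℚ (+ suc k) ℚ.* ℤ→ℚ b′)                    ≡⟨ cong (r ℚ.*_) (ℤ→ℚ-* (+ suc k) b′) ⟨
    r ℚ.* ℤ→ℚ (+ suc k * b′)                            ≡⟨ cong (λ z → r ℚ.* ℤ→ℚ z) (binomial-absorption k (t - c)) ⟩
    r ℚ.* ℤ→ℚ ((t - c - + k) * b)                       ≡⟨ cong (λ z → r ℚ.* ℤ→ℚ (z * b)) (reorder t c (+ k)) ⟩
    r ℚ.* ℤ→ℚ ((- (c + + k) + t) * b)                   ≡⟨ cong (r ℚ.*_) (ℤ→ℚ-* (- (c + + k) + t) b) ⟩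
    r ℚ.* (ℤ→ℚ (- (c + + k) + t) ℚ.* ℤ→ℚ b)             ≡⟨ cong (λ z → r ℚ.* (z ℚ.* ℤ→ℚ b)) (ℤ→ℚ-+ (- (c + + k)) t) ⟩
    r ℚ.* ((ℤ→ℚ (- (c + + k)) ℚ.+ ℤ→ℚ t) ℚ.* ℤ→ℚ b)     ≡⟨ distribute (ℤ→ℚ (- (c + + k))) r (ℤ→ℚ t) (ℤ→ℚ b) ⟩
    (ℤ→ℚ (- (c + + k)) ℚ.* r ℚ.+ r ℚ.* ℤ→ℚ t) ℚ.* ℤ→ℚ b ∎
    where
    b  = binomial (t - c) k
    b′ = binomial (t - c) (suc k)
    reorder : ∀ t c k → t - c - k ≡ - (c + k) + t
    reorder = solve-∀
    distribute : ∀ m r x u → r ℚ.* ((m ℚ.+ x) ℚ.* u) ≡ (m ℚ.* r ℚ.+ r ℚ.* x) ℚ.* u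
    distribute = solve 4 (λ m r x u → r :* ((m :+ x) :* u) := (m :* r :+ r :* x) :* u) refl

indicatorᶜ : ∀ {m} → Subset m → Fin m → ℤ
indicatorᶜ L ℓ with ℓ ∈? L
... | yes _ = 0ℤ
... | no  _ = 1ℤ

indicatorᶜ-∈ : ∀ {m} {L : Subset m} {ℓ} → ℓ ∈ L → indicatorᶜ L ℓ ≡ 0ℤ
indicatorᶜ-∈ {L = L} {ℓ} ℓ∈L with ℓ ∈? L
... | yes _   = refl
... | no  ℓ∉L = contradiction ℓ∈L ℓ∉L

indicatorᶜ-∉ : ∀ {m} {L : Subset m} {ℓ} → ℓ ∉ L → indicatorᶜ L ℓ ≡ 1ℤ
indicatorᶜ-∉ {L = L} {ℓ} ℓ∉L with ℓ ∈? L
... | yes ℓ∈L = contradiction ℓ∈L ℓ∉L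
... | no  _   = refl

separator : ∀ {n} → Subset (suc n) → ℤ → ℤ
separator {n} L t = sum λ ℓ → indicatorᶜ L ℓ * binomial (t - + suc (toℕ ℓ)) n

separator-polynomial : ∀ {n} (L : Subset (suc n)) → PolynomialOfDegree< (suc n) (separator L)
separator-polynomial {n} L =
  sum-polynomial λ ℓ → scale-polynomial (indicatorᶜ L ℓ) (binomial-polynomial (+ suc (toℕ ℓ)) n)

module PrimePowerModulus {p : ℕ} (p-prime : Prime p) (α : ℕ) {n : ℕ} (1+n≡p^α : suc n ≡ p ^ α) where

  -- (1 + n) C(n, k) = (k + 1) C(1 + n, k + 1), and p ^ α = 1 + n cannot divide k + 1 ≤ n.
  binomial-q-divisible : ∀ k → suc k ≤ n → binomial (+ suc n) (suc k) ≈ 0ℤ [mod p ]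
  binomial-q-divisible k k<n with p ℕD.∣? ℤ.∣ binomial (+ suc n) (suc k) ∣
  ... | yes p∣c = ∣⇒≈0 (∣ᵤ⇒∣ p∣c)
  ... | no p∤c = contradiction p^α≤1+k (ℕP.<⇒≱ (subst (suc k <_) 1+n≡p^α (ℕ.s≤s k<n)))
    where
    c = binomial (+ suc n) (suc k)
    absorbed : suc n ℕ.* ℤ.∣ binomial (+ n) k ∣ ≡ suc k ℕ.* ℤ.∣ c ∣
    absorbed = begin
      suc n ℕ.* ℤ.∣ binomial (+ n) k ∣  ≡⟨ ℤP.abs-* (+ suc n) (binomial (+ n) k) ⟨
      ℤ.∣ + suc n * binomial (+ n) k ∣  ≡⟨ cong ℤ.∣_∣ (binomial-absorption-suc k (+ n)) ⟨
      ℤ.∣ + suc k * c ∣                 ≡⟨ ℤP.abs-* (+ suc k) c ⟩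
      suc k ℕ.* ℤ.∣ c ∣                 ∎
      where open ≡-Reasoning
    p^α≤1+k : p ^ α ≤ suc k
    p^α≤1+k = ℕD.∣⇒≤ (prime-power-divisor p-prime p∤c α
                (subst (ℕD._∣ suc k ℕ.* ℤ.∣ c ∣) 1+n≡p^α (subst (suc n ℕD.∣_) absorbed (ℕD.m∣m*n _))))

  binomial-periodic : ∀ K → K ≤ n → ∀ y → binomial (y + + suc n) K ≈ binomial y K [mod p ]
  binomial-periodic zero    _   _ = ≈-reflexive refl
  binomial-periodic (suc k) k<n   = ≈-by-differences (binomial-q-divisible k k<n) Δ
    where
    open import Relation.Binary.Reasoning.Setoid (≈-setoid p)
    Δ : ∀ y → binomial (ℤ.suc y + + suc n) (suc k) - binomial (y + + suc n) (suc k)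
            ≈ binomial (ℤ.suc y) (suc k) - binomial y (suc k) [mod p ]
    Δ y = begin
      binomial (ℤ.suc y + + suc n) (suc k) - binomial (y + + suc n) (suc k)
        ≡⟨ cong (λ z → binomial z (suc k) - binomial (y + + suc n) (suc k)) (ℤP.+-assoc 1ℤ y (+ suc n)) ⟩
      binomial (ℤ.suc (y + + suc n)) (suc k) - binomial (y + + suc n) (suc k)
        ≡⟨ binomial-Δ (y + + suc n) k ⟩
      binomial (y + + suc n) k
        ≈⟨ binomial-periodic k (ℕP.<⇒≤ k<n) y ⟩
      binomial y k
        ≡⟨ binomial-Δ y k ⟨
      binomial (ℤ.suc y) (suc k) - binomial y (suc k) ∎

  binomial-n-periodic : ∀ y m → binomial (y + m * + suc n) n ≈ binomial y n [mod p ]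
  binomial-n-periodic y m = ≈-periodic-multiples (binomial-periodic n ℕP.≤-refl) m y

  binomial-n-vanishes : ∀ {x} → x < n → ∀ m → binomial (+ x + m * + suc n) n ≈ 0ℤ [mod p ]
  binomial-n-vanishes x<n m = ≈-trans (binomial-n-periodic _ m) (≈-reflexive (binomial-below x<n))

  binomial-n-same-class : ∀ r m → binomial (+ r + m * + suc n - + suc r) n ≈ 1ℤ [mod p ]
  binomial-n-same-class r m = begin
    binomial (+ r + m * + suc n - + suc r) n  ≡⟨ cong (λ z → binomial z n) (shift (+ r) (+ n) m) ⟩
    binomial (+ n + (m - 1ℤ) * + suc n) n     ≈⟨ binomial-n-periodic (+ n) (m - 1ℤ) ⟩
    binomial (+ n) n                          ≡⟨ binomial-diagonal n ⟩
    1ℤ                                        ∎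
    where
    open import Relation.Binary.Reasoning.Setoid (≈-setoid p)
    shift : ∀ r n m → r + m * (1ℤ + n) - (1ℤ + r) ≡ n + (m - 1ℤ) * (1ℤ + n)
    shift = solve-∀

  -- The argument is moved to a representative x < n of its class modulo 1 + n:
  -- x = r − c − 1 if c < r, and x = r + (n − c), one period lower, if r < c.
  binomial-n-other-class : ∀ {c r} → c ≤ n → r ≤ n → c ≢ r → ∀ m →
                           binomial (+ r + m * + suc n - + suc c) n ≈ 0ℤ [mod p ]
  binomial-n-other-class {c} {r} c≤n r≤n c≢r m with ℕP.<-cmp c r
  ... | tri≈ _ c≡r _ = contradiction c≡r c≢r
  ... | tri< c<r _ _ with ℕP.m≤n⇒∃[o]m+o≡n c<r
  ...   | v , refl = subst (λ z → binomial z n ≈ 0ℤ [mod p ]) (sym (drop (+ c) (+ v) m (+ suc n)))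
                       (binomial-n-vanishes (ℕP.≤-trans (ℕ.s≤s (ℕP.m≤n+m v c)) r≤n) m)
    where
    drop : ∀ c v m q → (1ℤ + c) + v + m * q - (1ℤ + c) ≡ v + m * q
    drop = solve-∀
  binomial-n-other-class {c} {r} c≤n r≤n c≢r m | tri> _ _ r<c with ℕP.m≤n⇒∃[o]m+o≡n c≤n
  ... | e , c+e≡n = subst (λ z → binomial z n ≈ 0ℤ [mod p ]) (sym (wrap r c e m n c+e≡n))
                      (binomial-n-vanishes (subst (r ℕ.+ e <_) c+e≡n (ℕP.+-monoˡ-< e r<c)) (m - 1ℤ))
    where
    wrap : ∀ r c e m n → c ℕ.+ e ≡ n → + r + m * + suc n - + suc c ≡ + (r ℕ.+ e) + (m - 1ℤ) * + suc n
    wrap r c e m _ refl = shift (+ r) (+ c) (+ e) m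
      where
      shift : ∀ r c e m → r + m * (1ℤ + (c + e)) - (1ℤ + c) ≡ (r + e) + (m - 1ℤ) * (1ℤ + (c + e))
      shift = solve-∀

  separator-≈-indicatorᶜ : ∀ (L : Subset (suc n)) ℓ s → s ≈ + toℕ ℓ [mod suc n ] →
                           separator L s ≈ indicatorᶜ L ℓ [mod p ]
  separator-≈-indicatorᶜ L ℓ s s≈ℓ with ≈⇒multiple s≈ℓ
  ... | m , refl = begin
    separator L (+ toℕ ℓ + m * + suc n)
      ≈⟨ sum-select-≈ (term (+ toℕ ℓ + m * + suc n)) ℓ off ⟩
    indicatorᶜ L ℓ * binomial (+ toℕ ℓ + m * + suc n - + suc (toℕ ℓ)) n
      ≈⟨ ≈-*-congˡ (indicatorᶜ L ℓ) (binomial-n-same-class (toℕ ℓ) m) ⟩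
    indicatorᶜ L ℓ * 1ℤ
      ≡⟨ ℤP.*-identityʳ (indicatorᶜ L ℓ) ⟩
    indicatorᶜ L ℓ ∎
    where
    open import Relation.Binary.Reasoning.Setoid (≈-setoid p)
    term : ℤ → Fin (suc n) → ℤ
    term t j = indicatorᶜ L j * binomial (t - + suc (toℕ j)) n
    off : ∀ j → j ≢ ℓ → term (+ toℕ ℓ + m * + suc n) j ≈ 0ℤ [mod p ]
    off j j≢ℓ = ≈-trans
      (≈-*-congˡ (indicatorᶜ L j)
        (binomial-n-other-class (FinP.toℕ≤pred[n] j) (FinP.toℕ≤pred[n] ℓ) (j≢ℓ ∘ FinP.toℕ-injective) m))
      (≈-reflexive (ℤP.*-zeroʳ (indicatorᶜ L j)))

  separator-on-L : ∀ L s → InLq (suc n) L s → separator L s ≈ 0ℤ [mod p ]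
  separator-on-L L s (ℓ , ℓ∈L , s≡ℓ) =
    ≈-trans (separator-≈-indicatorᶜ L ℓ s (≡-mod⇒≈ s _ s≡ℓ)) (≈-reflexive (indicatorᶜ-∈ ℓ∈L))

  separator-off-L : ∀ L s → InComplLq (suc n) L s → separator L s ≈ 1ℤ [mod p ]
  separator-off-L L s (ℓ , ℓ∉L , s≡ℓ) =
    ≈-trans (separator-≈-indicatorᶜ L ℓ s (≡-mod⇒≈ s _ s≡ℓ)) (≈-reflexive (indicatorᶜ-∉ ℓ∉L))

proposition3p1 : (p α : ℕ) → Prime p → 1 ≤ α →
    (L : Subset (p ^ α)) → L ⊂ ⊤ →
    ∃ λ (F : Poly) → ∃ λ (g : ℤ → ℤ) →
      (∀ (t : ℤ) → eval F (ℤ→ℚ t) ≡ ℤ→ℚ (g t)) ×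
      Separates p g (InComplLq (p ^ α) L) (InLq (p ^ α) L) ×
      (∀ (m : ℤ) → (∀ (ℓ : Fin (p ^ α)) → ℓ ∈ L → ¬ (m ≡ ℤ.+ (toℕ ℓ) [mod p ^ α ])) →
        g m ≡ ℤ.1ℤ [mod p ]) ×
      (∀ (s : ℤ) → (∃ λ (ℓ : Fin (p ^ α)) → ℓ ∈ L × (s ≡ ℤ.+ (toℕ ℓ) [mod p ^ α ])) →
        g s ≡ ℤ.0ℤ [mod p ]) ×
      length F ≤ p ^ α
proposition3p1 p α p-prime _ L _ with p ^ α in p^α≡q
... | zero  = contradiction p^α≡q (ℕ.≢-nonZero⁻¹ _ {{ℕP.m^n≢0 p α}})
  where instance _ = prime⇒nonZero p-prime
... | suc n =
  coefficients F , separator L , eval≡ F ,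
  separates-by-residues prime⇒1<p (separator-off-L L) (separator-on-L L) ,
  (λ m m∉L → ≈⇒≡-mod (separator-off-L L m (avoiding⇒InComplLq L m m∉L))) ,
  (λ s s∈L → ≈⇒≡-mod (separator-on-L L s s∈L)) ,
  length≤ F
  where
  open PrimePowerModulus p-prime α (sym p^α≡q)
  F = separator-polynomial L
  prime⇒1<p : 1 < p
  prime⇒1<p = ℕ.nonTrivial⇒n>1 p {{prime⇒nonTrivial p-prime}}
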